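{- Let $\mathcal{K}=\langle V,E,\ell\rangle$ be a Kripke structure, $x\in V$, and $\Phi$ an SML formula. Let $\psi$ be a subformula of $\Phi$ occurring at $\{\langle\mathrm{gone}\rangle,\langle\mathrm{gone}\rangle_{loc}\}$-depth $n$ in $\Phi$, and let $E_d=\{(x_0,y_0),\ldots,(x_{n-1},y_{n-1})\}\subseteq E$. Let $\mathcal{K}'=\langle V',E',\ell'\rangle$ be the structure built from $\mathcal{K}$ as described in the context, and let $\ell''$ be the labelling of $V'$ defined by $\ell''(v)=\{\mathsf{inter},\mathsf{del}_i\}$ if $v=v_{x_iy_i}$ for some $i\in\{0,\ldots,n-1\}$, and $\ell''(v)=\ell'(v)$ otherwise. Then \[\langle V,E\setminus E_d,\ell\rangle,x\models\psi \quad\text{iff}\quad \langle V',E',\ell''\rangle,x\models \widetilde{\psi}^{\,n}.\]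
   Context: Kripke structures: $AP$ is a finite set of atomic propositions; a Kripke structure is $\langle V,E,\ell\rangle$ with $V$ finite, $E\subseteq V\times V$, $\ell:V\to 2^{AP}$ (for QCTL evaluation every vertex is assumed to have a successor). SML (Sabotage Modal Logic) formulas are built from atomic propositions, $\top$, $\neg$, $\wedge$, and the modalities $\Diamond$ (with dual $\Box=\neg\Diamond\neg$), $\langle\mathrm{gone}\rangle$ (with dual $[\mathrm{gone}]=\neg\langle\mathrm{gone}\rangle\neg$) and $\langle\mathrm{gone}\rangle_{loc}$. Semantics at a state $x$ of $\langle V,E,\ell\rangle$: $p$ holds iff $p\in\ell(x)$; Booleans as usual; $\Diamond\varphi$ holds iff there is $(x,x')\in E$ with $\langle V,E,\ell\rangle,x'\models\varphi$; $\langle\mathrm{gone}\rangle\varphi$ holds iff there is $(y,y')\in E$ with $\langle V,E\setminus\{(y,y')\},\ell\rangle,x\models\varphi$; $\langle\mathrm{gone}\rangle_{loc}\varphi$ holds iff there is $(x,x')\in E$ with $\langle V,E\setminus\{(x,x')\},\ell\rangle,x\models\varphi$. The $\{\langle\mathrm{gone}\rangle,\langle\mathrm{gone}\rangle_{loc}\}$-depth of a subformula is the number of $\langle\mathrm{gone}\rangle$/$\langle\mathrm{gone}\rangle_{loc}$ modalities in whose scope it occurs. QCTL: formulas $\varphi::= q\mid\neg\varphi\mid\varphi\vee\varphi\mid \mathsf{EX}\varphi\mid \mathsf{E}\varphi\mathsf{U}\varphi\mid\mathsf{A}\varphi\mathsf{U}\varphi\mid\exists p.\varphi$, evaluated at states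 of Kripke structures with the usual CTL semantics for temporal operators over infinite paths, and (structure semantics) $\mathcal{K},x\models\exists p.\varphi$ iff there is a Kripke structure with the same vertices and edges as $\mathcal{K}$ whose labelling agrees with $\ell$ on all propositions other than $p$, in which $\varphi$ holds at $x$. Abbreviations: $\mathsf{EF}\varphi=\mathsf{E}\top\mathsf{U}\varphi$, $\mathsf{AG}\varphi=\neg\mathsf{EF}\neg\varphi$, $\forall p.\varphi=\neg\exists p.\neg\varphi$, $\mathsf{E}_{=1}\mathsf{F}\varphi=\mathsf{EF}\varphi\wedge\forall q.(\mathsf{EF}(q\wedge\varphi)\to\mathsf{AG}(\varphi\to q))$ with $q$ fresh, and $\exists^1p.\varphi=\exists p.((\mathsf{E}_{=1}\mathsf{F}\,p)\wedge\varphi)$. Construction of $\mathcal{K}'$: $V'=V\cup\{v_{xy}\mid (x,y)\in E\}$ (fresh vertices); $E'=\{(x,v_{xy}),(v_{xy},y)\mid (x,y)\in E\}\cup\{(x,y)\mid x,y\in V\}$; $\ell'(x)=\ell(x)$ for $x\in V$ and $\ell'(v_{xy})=\{\mathsf{inter}\}$, where $\mathsf{inter},\mathsf{del}_0,\mathsf{del}_1,\ldots$ are fresh atomic propositions. Translation $\widetilde{\varphi}^{\,n}$ (with $n$ a natural number): $\widetilde{p}^{\,n}=p$; $\widetilde{\top}^{\,n}=\top$; $\widetilde{\varphi\wedge\psi}^{\,n}=\widetilde{\varphi}^{\,n}\wedge\widetilde{\psi}^{\,n}$; $\widetilde{\neg\varphi}^{\,n}=\neg\widetilde{\varphi}^{\,n}$;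 $\widetilde{\Diamond\varphi}^{\,n}=\mathsf{EX}(\mathsf{inter}\wedge\bigwedge_{0\le i<n}\neg\mathsf{del}_i\wedge\mathsf{EX}\,\widetilde{\varphi}^{\,n})$; $\widetilde{\langle\mathrm{gone}\rangle\varphi}^{\,n}=\exists^1\mathsf{del}_n.\big(\mathsf{EX}\,\mathsf{EX}(\mathsf{inter}\wedge\bigwedge_{0\le i<n}\neg\mathsf{del}_i\wedge\mathsf{del}_n)\wedge\widetilde{\varphi}^{\,n+1}\big)$; $\widetilde{\langle\mathrm{gone}\rangle_{loc}\varphi}^{\,n}=\exists^1\mathsf{del}_n.\big(\mathsf{EX}(\mathsf{inter}\wedge\bigwedge_{0\le i<n}\neg\mathsf{del}_i\wedge\mathsf{del}_n)\wedge\widetilde{\varphi}^{\,n+1}\big)$. Dual modalities are translated via their definitions as negations. -}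

module Defs where

open import Data.Nat using (ℕ; zero; suc; _<_; _<?_)
open import Data.Fin using (Fin; fromℕ<) renaming (zero to fz; suc to fs)
open import Data.Fin.Properties using (_≟_)
open import Data.Bool using (Bool; true; false; _∧_; _∨_; not)
open import Data.Product using (Σ; _×_; _,_; proj₁; proj₂)
open import Data.Sum using (_⊎_)
open import Data.Unit using (⊤)
open import Data.Empty using (⊥)
open import Relation.Nullary using (¬_; yes; no)
open import Relation.Nullary.Decidable using (⌊_⌋)
open import Relation.Binary.PropositionalEquality using (_≡_; _≢_)

Edges : ℕ → Set
Edges k = Fin k → Fin k → Bool

Labelling : ℕ → ℕ → Set
Labelling k m = Fin k → Fin m → Bool

_==ᶠ_ : ∀ {k} → Fin k → Fin k → Bool
a ==ᶠ b = ⌊ a ≟ b ⌋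

removeEdge : ∀ {k} → Edges k → Fin k → Fin k → Edges k
removeEdge E a b y z = E y z ∧ not ((y ==ᶠ a) ∧ (z ==ᶠ b))

anyFin : ∀ {n} → (Fin n → Bool) → Bool
anyFin {zero} f = false
anyFin {suc n} f = f fz ∨ anyFin (λ i → f (fs i))

removeEdges : ∀ {k n} → Edges k → (Fin n → Fin k × Fin k) → Edges k
removeEdges E Ed y z =
  E y z ∧ not (anyFin (λ i → (y ==ᶠ proj₁ (Ed i)) ∧ (z ==ᶠ proj₂ (Ed i))))

data SML (m : ℕ) : Set where
  atom    : Fin m → SML m
  ⊤ˢ      : SML m
  ¬ˢ_     : SML m → SML m
  _∧ˢ_    : SML m → SML m → SML m
  ◇       : SML m → SML m
  gone    : SML m → SML m
  goneLoc : SML m → SML m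

□ : ∀ {m} → SML m → SML m
□ φ = ¬ˢ ◇ (¬ˢ φ)

[gone] : ∀ {m} → SML m → SML m
[gone] φ = ¬ˢ gone (¬ˢ φ)

sat : ∀ {k m} → Edges k → Labelling k m → Fin k → SML m → Set
sat E ℓ x (atom p) = ℓ x p ≡ true
sat E ℓ x ⊤ˢ = ⊤
sat E ℓ x (¬ˢ φ) = ¬ sat E ℓ x φ
sat E ℓ x (φ ∧ˢ ψ) = sat E ℓ x φ × sat E ℓ x ψ
sat {k} E ℓ x (◇ φ) = Σ (Fin k) λ x' → E x x' ≡ true × sat E ℓ x' φ
sat {k} E ℓ x (gone φ) =
  Σ (Fin k) λ y → Σ (Fin k) λ y' → E y y' ≡ true × sat (removeEdge E y y') ℓ x φ
sat {k} E ℓ x (goneLoc φ) =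
  Σ (Fin k) λ x' → E x x' ≡ true × sat (removeEdge E x x') ℓ x φ

data OccursAt {m : ℕ} (ψ : SML m) : SML m → ℕ → Set where
  here      : OccursAt ψ ψ 0
  in¬       : ∀ {φ n} → OccursAt ψ φ n → OccursAt ψ (¬ˢ φ) n
  in∧ˡ      : ∀ {φ χ n} → OccursAt ψ φ n → OccursAt ψ (φ ∧ˢ χ) n
  in∧ʳ      : ∀ {φ χ n} → OccursAt ψ χ n → OccursAt ψ (φ ∧ˢ χ) n
  in◇       : ∀ {φ n} → OccursAt ψ φ n → OccursAt ψ (◇ φ) n
  inGone    : ∀ {φ n} → OccursAt ψ φ n → OccursAt ψ (gone φ) (suc n)
  inGoneLoc : ∀ {φ n} → OccursAt ψ φ n → OccursAt ψ (goneLoc φ) (suc n)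

-- QCTL: propositions are AP plus fresh inter, del_0, del_1, ..., and a
-- fresh q used in the abbreviation E_{=1}F.

data QProp (m : ℕ) : Set where
  ap    : Fin m → QProp m
  inter : QProp m
  del   : ℕ → QProp m
  qfr   : QProp m

data QCTL (m : ℕ) : Set where
  var   : QProp m → QCTL m
  ¬q_   : QCTL m → QCTL m
  _∨q_  : QCTL m → QCTL m → QCTL m
  EX    : QCTL m → QCTL m
  E[_U_] : QCTL m → QCTL m → QCTL m
  A[_U_] : QCTL m → QCTL m → QCTL m
  ∃q    : QProp m → QCTL m → QCTL m

record QKS (m : ℕ) : Set₁ where
  field
    St   : Set
    edge : St → St → Set
    lab  : St → QProp m → Bool
open QKS public

IsPathFrom : ∀ {m} (K : QKS m) → St K → (ℕ → St K) → Set
IsPathFrom K x π = π 0 ≡ x × (∀ i → edge K (π i) (π (suc i)))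

qsat : ∀ {m} (K : QKS m) → St K → QCTL m → Set
qsat K x (var p) = lab K x p ≡ true
qsat K x (¬q φ) = ¬ qsat K x φ
qsat K x (φ ∨q ψ) = qsat K x φ ⊎ qsat K x ψ
qsat K x (EX φ) = Σ (St K) λ y → edge K x y × qsat K y φ
qsat K x (E[ φ U ψ ]) =
  Σ (ℕ → St K) λ π → IsPathFrom K x π ×
    Σ ℕ λ j → qsat K (π j) ψ × (∀ i → i < j → qsat K (π i) φ)
qsat K x (A[ φ U ψ ]) =
  (π : ℕ → St K) → IsPathFrom K x π →
    Σ ℕ λ j → qsat K (π j) ψ × (∀ i → i < j → qsat K (π i) φ)
qsat K x (∃q p φ) =
  Σ (St K → QProp _ → Bool) λ lab' →
    (∀ v q → q ≢ p → lab' v q ≡ lab K v q) ×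
    qsat (record { St = St K ; edge = edge K ; lab = lab' }) x φ

_∧q_ : ∀ {m} → QCTL m → QCTL m → QCTL m
φ ∧q ψ = ¬q ((¬q φ) ∨q (¬q ψ))
infixr 6 _∧q_

_→q_ : ∀ {m} → QCTL m → QCTL m → QCTL m
φ →q ψ = (¬q φ) ∨q ψ

⊤q : ∀ {m} → QCTL m
⊤q = var qfr ∨q (¬q var qfr)

EF : ∀ {m} → QCTL m → QCTL m
EF φ = E[ ⊤q U φ ]

AG : ∀ {m} → QCTL m → QCTL m
AG φ = ¬q EF (¬q φ)

∀q : ∀ {m} → QProp m → QCTL m → QCTL m
∀q p φ = ¬q ∃q p (¬q φ)

-- E_{=1}F φ, with q := qfr (fresh for the formulas φ = del_n it is used on)
E=1F : ∀ {m} → QCTL m → QCTL m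
E=1F φ = EF φ ∧q ∀q qfr (EF (var qfr ∧q φ) →q AG (φ →q var qfr))

∃¹ : ∀ {m} → QProp m → QCTL m → QCTL m
∃¹ p φ = ∃q p (E=1F (var p) ∧q φ)

notDelBelow : ∀ {m} → ℕ → QCTL m
notDelBelow zero = ⊤q
notDelBelow (suc i) = notDelBelow i ∧q (¬q var (del i))

tr : ∀ {m} → ℕ → SML m → QCTL m
tr n (atom p) = var (ap p)
tr n ⊤ˢ = ⊤q
tr n (¬ˢ φ) = ¬q tr n φ
tr n (φ ∧ˢ ψ) = tr n φ ∧q tr n ψ
tr n (◇ φ) = EX (var inter ∧q notDelBelow n ∧q EX (tr n φ))
tr n (gone φ) =
  ∃¹ (del n) (EX (EX (var inter ∧q notDelBelow n ∧q var (del n))) ∧q tr (suc n) φ)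
tr n (goneLoc φ) =
  ∃¹ (del n) (EX (var inter ∧q notDelBelow n ∧q var (del n)) ∧q tr (suc n) φ)

data V' {k : ℕ} (E : Edges k) : Set where
  old : Fin k → V' E
  mid : (x y : Fin k) → E x y ≡ true → V' E

E' : ∀ {k} {E : Edges k} → V' E → V' E → Set
E' (old x) (old y) = ⊤
E' (old x) (mid x' y' _) = x ≡ x'
E' (mid x y _) (old y') = y ≡ y'
E' (mid _ _ _) (mid _ _ _) = ⊥

ℓ' : ∀ {k m} {E : Edges k} → Labelling k m → V' E → QProp m → Bool
ℓ' ℓ (old x) (ap p) = ℓ x p
ℓ' ℓ (old x) _ = false
ℓ' ℓ (mid _ _ _) inter = true
ℓ' ℓ (mid _ _ _) _ = false

delLabel : ∀ {k} (n : ℕ) → (Fin n → Fin k × Fin k) → Fin k → Fin k → ℕ → Bool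
delLabel n Ed x y j with j <? n
... | yes j<n = (x ==ᶠ proj₁ (Ed (fromℕ< j<n))) ∧ (y ==ᶠ proj₂ (Ed (fromℕ< j<n)))
... | no _ = false

ℓ'' : ∀ {k m} {E : Edges k} → Labelling k m → (n : ℕ) → (Fin n → Fin k × Fin k) →
      V' E → QProp m → Bool
ℓ'' ℓ n Ed (mid x y _) (del j) = delLabel n Ed x y j
ℓ'' ℓ n Ed v q = ℓ' ℓ v q

K'' : ∀ {k m} (E : Edges k) → Labelling k m → (n : ℕ) → (Fin n → Fin k × Fin k) → QKS m
K'' E ℓ n Ed = record { St = V' E ; edge = E' ; lab = ℓ'' ℓ n Ed }

module Submission where

-- The translation is correct under an invariant tying the current
-- edge set to the labelling of K′: an edge (a,b) of E has been deleted exactly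
-- when one of del_0, …, del_(n-1) holds at v_ab. ⟨gone⟩φ at depth n is then
-- simulated by relabelling del_n so that it marks the intermediate vertex of the
-- deleted edge; E_{=1}F forces this vertex to be unique, and since every vertex
-- of K′ is reachable within two steps from any vertex of V, uniqueness along
-- paths is uniqueness in K′. The proof is by induction on ψ for all depths and
-- invariant-respecting labellings at once; as QCTL conjunction is encoded with
-- negations, one direction holds only up to double negation, which is removed
-- because SML satisfaction on a finite structure is decidable.

open import Defs
open import Level using (0ℓ)
open import Data.Nat as ℕ using (ℕ; zero; suc; _<_; _<?_)
open import Data.Nat.Properties using (m<1+n⇒m<n∨m≡n; m<n⇒m<1+n; n<1+n; <-irrefl)
open import Data.Fin using (Fin; fromℕ<; toℕ) renaming (zero to fz; suc to fs)
open import Data.Fin.Properties using (any?; toℕ<n; fromℕ<-toℕ) renaming (_≟_ to _≟ᶠ_)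
open import Data.Bool as Bool using (Bool; true; false; _∧_; _∨_; not)
open import Data.Bool.Properties using (¬-not; not-injective)
open import Data.Product using (Σ; _×_; _,_; proj₁; proj₂)
open import Data.Product.Function.NonDependent.Propositional using (_×-⇔_)
open import Data.Sum using (_⊎_; inj₁; inj₂)
open import Data.Unit using (tt)
open import Data.Empty using (⊥; ⊥-elim)
open import Function using (_∘_; const)
open import Function.Bundles using (_⇔_; mk⇔; Equivalence)
open import Function.Properties.Equivalence
  using (⇔-setoid) renaming (sym to ⇔-sym; trans to ⇔-trans)
open import Relation.Nullary using (¬_; Dec; does; yes; no; contradiction)
open import Relation.Nullary.Decidable
  using (map′; decidable-stable; dec-true; dec-false; _×-dec_; ¬?)
open import Relation.Nullary.Negation using (¬¬-Monad; ¬¬-map)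
open import Relation.Binary.Definitions using (DecidableEquality)
open import Relation.Binary.PropositionalEquality using (_≡_; _≢_; refl; sym; trans; cong; subst)
open import Axiom.UniquenessOfIdentityProofs using (module Decidable⇒UIP)
open import Effect.Monad using (RawMonad)

open Equivalence using (to; from)
open RawMonad (¬¬-Monad {0ℓ}) using (return; _>>=_)

≡false⇒≢true : ∀ {b} → b ≡ false → b ≢ true
≡false⇒≢true refl ()

≡-stable : ∀ {b c : Bool} → ¬ ¬ b ≡ c → b ≡ c
≡-stable {b} {c} = decidable-stable (b Bool.≟ c)

≡true-⇔⇒≡ : ∀ {b c} → b ≡ true ⇔ c ≡ true → b ≡ c
≡true-⇔⇒≡ {true} b⇔c = sym (to b⇔c refl)
≡true-⇔⇒≡ {false} {false} _ = refl
≡true-⇔⇒≡ {false} {true} b⇔c = from b⇔c refl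

∧-≡-true : ∀ {a b} → a ∧ b ≡ true ⇔ (a ≡ true × b ≡ true)
∧-≡-true {true} {true} = mk⇔ (const (refl , refl)) (const refl)
∧-≡-true {true} {false} = mk⇔ (λ ()) proj₂
∧-≡-true {false} = mk⇔ (λ ()) proj₁

∨-≡-false : ∀ {a b} → a ∨ b ≡ false ⇔ (a ≡ false × b ≡ false)
∨-≡-false {false} {false} = mk⇔ (const (refl , refl)) (const refl)
∨-≡-false {false} {true} = mk⇔ (λ ()) proj₂
∨-≡-false {true} = mk⇔ (λ ()) proj₁

not-≡-true : ∀ {b} → not b ≡ true ⇔ b ≡ false
not-≡-true = mk⇔ not-injective (cong not)

==ᶠ-refl : ∀ {k} (a : Fin k) → (a ==ᶠ a) ≡ true
==ᶠ-refl a with a ≟ᶠ a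
... | yes _ = refl
... | no a≢a = contradiction refl a≢a

==ᶠ-true : ∀ {k} {a b : Fin k} → (a ==ᶠ b) ≡ true → a ≡ b
==ᶠ-true {a = a} {b} h with a ≟ᶠ b
... | yes a≡b = a≡b

anyFin-≡-false : ∀ {n} (f : Fin n → Bool) → anyFin f ≡ false ⇔ (∀ i → f i ≡ false)
anyFin-≡-false {zero} f = mk⇔ (λ _ ()) (const refl)
anyFin-≡-false {suc n} f = mk⇔ none-true all-false
  where
  none-true : anyFin f ≡ false → ∀ i → f i ≡ false
  none-true h fz = proj₁ (to ∨-≡-false h)
  none-true h (fs i) = to (anyFin-≡-false (f ∘ fs)) (proj₂ (to ∨-≡-false h)) i
  all-false : (∀ i → f i ≡ false) → anyFin f ≡ false
  all-false h = from ∨-≡-false (h fz , from (anyFin-≡-false (f ∘ fs)) (h ∘ fs))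

∀<suc-⇔ : ∀ {n} {P : ℕ → Set} → (∀ j → j < suc n → P j) ⇔ ((∀ j → j < n → P j) × P n)
∀<suc-⇔ {n} {P} = mk⇔ (λ h → (λ j → h j ∘ m<n⇒m<1+n) , h n (n<1+n n)) split
  where
  split : (∀ j → j < n → P j) × P n → ∀ j → j < suc n → P j
  split (below , at) j j<1+n with m<1+n⇒m<n∨m≡n j<1+n
  ... | inj₁ j<n = below j j<n
  ... | inj₂ refl = at

∀-Fin-⇔-∀-< : ∀ {n} {P : Fin n → Set} → (∀ i → P i) ⇔ (∀ j (j<n : j < n) → P (fromℕ< j<n))
∀-Fin-⇔-∀-< {P = P} =
  mk⇔ (λ h j j<n → h _) (λ h i → subst P (fromℕ<-toℕ i (toℕ<n i)) (h (toℕ i) (toℕ<n i)))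

-- qsat K v (φ ∧q ψ) unfolds to  ¬ (¬ qsat K v φ ⊎ ¬ qsat K v ψ).
∧q-intro : ∀ {A B : Set} → A → B → ¬ (¬ A ⊎ ¬ B)
∧q-intro a b (inj₁ ¬a) = ¬a a
∧q-intro a b (inj₂ ¬b) = ¬b b

∧q-elim : ∀ {A B : Set} → ¬ (¬ A ⊎ ¬ B) → ¬ ¬ (A × B)
∧q-elim h ¬both = h (inj₁ λ a → h (inj₂ λ b → ¬both (a , b)))

deletedEdge : ∀ {m} → ℕ → QCTL m
deletedEdge n = var inter ∧q notDelBelow n ∧q var (del n)

relabel : ∀ {m} (K : QKS m) → (St K → QProp m → Bool) → QKS m
relabel K L = record { St = St K ; edge = edge K ; lab = L }

Reach : ∀ {m} (K : QKS m) → St K → St K → Set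
Reach K x w = Σ (ℕ → St K) λ π → IsPathFrom K x π × Σ ℕ λ j → π j ≡ w

module _ {m : ℕ} (K : QKS m) where

  ⊤q-holds : ∀ v → qsat K v ⊤q
  ⊤q-holds v with lab K v qfr
  ... | true = inj₁ refl
  ... | false = inj₂ λ ()

  notDelBelow-⇔ : ∀ {v} n → qsat K v (notDelBelow n) ⇔ (∀ j → j < n → lab K v (del j) ≡ false)
  notDelBelow-⇔ {v} n = mk⇔ (unmarked n) (marks-absent n)
    where
    unmarked : ∀ n → qsat K v (notDelBelow n) → ∀ j → j < n → lab K v (del j) ≡ false
    unmarked (suc i) h j j<1+i with m<1+n⇒m<n∨m≡n j<1+i
    ... | inj₁ j<i = ¬-not λ t → h (inj₁ λ below → ≡false⇒≢true (unmarked i below j j<i) t)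
    ... | inj₂ refl = ¬-not λ t → h (inj₂ λ ¬t → ¬t t)
    marks-absent : ∀ n → (∀ j → j < n → lab K v (del j) ≡ false) → qsat K v (notDelBelow n)
    marks-absent zero _ = ⊤q-holds v
    marks-absent (suc i) f =
      ∧q-intro (marks-absent i λ j → f j ∘ m<n⇒m<1+n) (≡false⇒≢true (f i (n<1+n i)))

  deletedEdge-⇔ : ∀ {v} n → qsat K v (deletedEdge n) ⇔
    (lab K v inter ≡ true × (∀ j → j < n → lab K v (del j) ≡ false) × lab K v (del n) ≡ true)
  deletedEdge-⇔ {v} n =
    mk⇔ facts λ (i , below , at) → ∧q-intro i (∧q-intro (from (notDelBelow-⇔ n) below) at)
    where
    facts : qsat K v (deletedEdge n) →
            lab K v inter ≡ true × (∀ j → j < n → lab K v (del j) ≡ false) × lab K v (del n) ≡ true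
    facts h = ≡-stable (¬¬-map proj₁ all) ,
              (λ j j<n → ≡-stable (¬¬-map (λ (_ , below , _) → to (notDelBelow-⇔ n) below j j<n) all)) ,
              ≡-stable (¬¬-map (proj₂ ∘ proj₂) all)
      where
      all : ¬ ¬ (lab K v inter ≡ true × qsat K v (notDelBelow n) × lab K v (del n) ≡ true)
      all = do
        (i , rest) ← ∧q-elim h
        (below , at) ← ∧q-elim rest
        return (i , below , at)

  EF-intro : ∀ {x w} φ → Reach K x w → qsat K w φ → qsat K x (EF φ)
  EF-intro φ (π , path , j , refl) q = π , path , j , q , λ i _ → ⊤q-holds (π i)

  EF-target : ∀ {x} φ → qsat K x (EF φ) → Σ (St K) λ w → qsat K w φ
  EF-target φ (π , _ , j , q , _) = π j , q

_≟ᴾ_ : ∀ {m} → DecidableEquality (QProp m)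
ap p ≟ᴾ ap q = map′ (cong ap) (λ { refl → refl }) (p ≟ᶠ q)
inter ≟ᴾ inter = yes refl
del i ≟ᴾ del j = map′ (cong del) (λ { refl → refl }) (i ℕ.≟ j)
qfr ≟ᴾ qfr = yes refl
ap _ ≟ᴾ inter = no λ ()
ap _ ≟ᴾ del _ = no λ ()
ap _ ≟ᴾ qfr = no λ ()
inter ≟ᴾ ap _ = no λ ()
inter ≟ᴾ del _ = no λ ()
inter ≟ᴾ qfr = no λ ()
del _ ≟ᴾ ap _ = no λ ()
del _ ≟ᴾ inter = no λ ()
del _ ≟ᴾ qfr = no λ ()
qfr ≟ᴾ ap _ = no λ ()
qfr ≟ᴾ inter = no λ ()
qfr ≟ᴾ del _ = no λ ()

update : ∀ {m} {S : Set} → (S → QProp m → Bool) → QProp m → (S → Bool) → S → QProp m → Bool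
update L p M v q with q ≟ᴾ p
... | yes _ = M v
... | no _ = L v q

module _ {m : ℕ} {S : Set} (L : S → QProp m → Bool) (M : S → Bool) where

  update-≡ : ∀ p v → update L p M v p ≡ M v
  update-≡ p v with p ≟ᴾ p
  ... | yes _ = refl
  ... | no p≢p = contradiction refl p≢p

  update-≢ : ∀ p v q → q ≢ p → update L p M v q ≡ L v q
  update-≢ p v q q≢p with q ≟ᴾ p
  ... | yes q≡p = contradiction q≡p q≢p
  ... | no _ = refl

-- The abbreviation E=1F uses qfr as its bound proposition, so p must differ from it.
module _ {m : ℕ} (K : QKS m) {x : St K} (reach : ∀ w → Reach K x w)
         {p : QProp m} (p≢qfr : p ≢ qfr) where

  Separates : QCTL m
  Separates = EF (var qfr ∧q var p) →q AG (var p →q var qfr)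

  E=1F-intro : ∀ {w} → lab K w p ≡ true → (∀ v → lab K v p ≡ true → v ≡ w) →
               qsat K x (E=1F (var p))
  E=1F-intro {w} pw unique = ∧q-intro (EF-intro K (var p) (reach w) pw) every-qfr-separates
    where
    every-qfr-separates : qsat K x (∀q qfr Separates)
    every-qfr-separates (L , agree , ¬separates) =
      ¬separates (inj₂ λ ef-t → ¬separates (inj₁ λ ef-s →
        clash (EF-target K′ (var qfr ∧q var p) ef-s) (EF-target K′ (¬q (var p →q var qfr)) ef-t)))
      where
      K′ = relabel K L
      only-w : ∀ v → ¬ ¬ L v p ≡ true → v ≡ w
      only-w v ¬¬pv = unique v (trans (sym (agree v p p≢qfr)) (≡-stable ¬¬pv))
      clash : Σ (St K) (λ s → qsat K′ s (var qfr ∧q var p)) →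
              Σ (St K) (λ t → qsat K′ t (¬q (var p →q var qfr))) → ⊥
      clash (s , qs) (t , qt) =
        qs (inj₁ λ qfr-s → qt (inj₂ (subst (λ u → L u qfr ≡ true) s≡t qfr-s)))
        where
        s≡t : s ≡ t
        s≡t = trans (only-w s (qs ∘ inj₂)) (sym (only-w t (qt ∘ inj₁)))

  -- If s ≢ t, labelling qfr by  v ≡ s  gives a qfr that does not separate.
  E=1F-unique : DecidableEquality (St K) → qsat K x (E=1F (var p)) →
                ∀ {s t} → lab K s p ≡ true → lab K t p ≡ true → s ≡ t
  E=1F-unique _≟_ h {s} {t} ps pt with s ≟ t
  ... | yes s≡t = s≡t
  ... | no s≢t = ⊥-elim (h (inj₂ λ every → every (L , update-≢ (lab K) is-s qfr , does-not-separate)))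
    where
    is-s : St K → Bool
    is-s v = does (v ≟ s)
    L : St K → QProp m → Bool
    L = update (lab K) qfr is-s
    p-kept : ∀ v → L v p ≡ lab K v p
    p-kept v = update-≢ (lab K) is-s qfr v p p≢qfr
    qfr-at : ∀ v → L v qfr ≡ does (v ≟ s)
    qfr-at = update-≡ (lab K) is-s qfr
    does-not-separate : ¬ qsat (relabel K L) x Separates
    does-not-separate (inj₁ ¬ef) = ¬ef (EF-intro (relabel K L) (var qfr ∧q var p) (reach s)
      (∧q-intro (trans (qfr-at s) (dec-true (s ≟ s) refl)) (trans (p-kept s) ps)))
    does-not-separate (inj₂ ag) = ag (EF-intro (relabel K L) (¬q (var p →q var qfr)) (reach t) λ
      { (inj₁ ¬pt) → ¬pt (trans (p-kept t) pt)
      ; (inj₂ qfr-t) → ≡false⇒≢true (dec-false (t ≟ s) (s≢t ∘ sym)) (trans (sym (qfr-at t)) qfr-t) })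

module Translation {m k : ℕ} (E : Edges k) (ℓ : Labelling k m) where

  VLabelling : Set
  VLabelling = V' E → QProp m → Bool

  K⟨_⟩ : VLabelling → QKS m
  K⟨ L ⟩ = record { St = V' E ; edge = E' ; lab = L }

  open Decidable⇒UIP Bool._≟_ using (≡-irrelevant)

  _≟V_ : DecidableEquality (V' E)
  old a ≟V old b = map′ (cong old) (λ { refl → refl }) (a ≟ᶠ b)
  old _ ≟V mid _ _ _ = no λ ()
  mid _ _ _ ≟V old _ = no λ ()
  mid a b e ≟V mid a′ b′ e′ with a ≟ᶠ a′ | b ≟ᶠ b′
  ... | yes refl | yes refl = yes (cong (mid a b) (≡-irrelevant e e′))
  ... | no a≢a′ | _ = no λ { refl → a≢a′ refl }
  ... | yes _ | no b≢b′ = no λ { refl → b≢b′ refl }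

  walk : Fin k → V' E → ℕ → V' E
  walk x w zero = old x
  walk x (old y) (suc _) = old y
  walk x (mid a b e) 1 = old a
  walk x (mid a b e) 2 = mid a b e
  walk x (mid a b e) (suc (suc (suc _))) = old b

  walk-edge : ∀ x w i → E' (walk x w i) (walk x w (suc i))
  walk-edge x (old y) zero = tt
  walk-edge x (old y) (suc _) = tt
  walk-edge x (mid a b e) zero = tt
  walk-edge x (mid a b e) 1 = refl
  walk-edge x (mid a b e) 2 = refl
  walk-edge x (mid a b e) (suc (suc (suc _))) = tt

  reach : ∀ {L} x w → Reach K⟨ L ⟩ (old x) w
  reach x w@(old _) = walk x w , (refl , walk-edge x w) , 2 , refl
  reach x w@(mid _ _ _) = walk x w , (refl , walk-edge x w) , 2 , refl

  EX-mid : ∀ {L a b e} χ → qsat K⟨ L ⟩ (mid a b e) (EX χ) → qsat K⟨ L ⟩ (old b) χ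
  EX-mid χ (old _ , refl , q) = q

  marks : Fin k → Fin k → V' E → Bool
  marks y y′ (old _) = false
  marks y y′ (mid a b _) = (a ==ᶠ y) ∧ (b ==ᶠ y′)

  marks-true-⇔ : ∀ {y y′} (e : E y y′ ≡ true) v → marks y y′ v ≡ true ⇔ v ≡ mid y y′ e
  marks-true-⇔ {y} {y′} e v = mk⇔ (marked v) λ { refl → from ∧-≡-true (==ᶠ-refl y , ==ᶠ-refl y′) }
    where
    marked : ∀ v → marks y y′ v ≡ true → v ≡ mid y y′ e
    marked (mid a b e′) h with to (∧-≡-true {a ==ᶠ y}) h
    ... | a==y , b==y′ with ==ᶠ-true {a = a} a==y | ==ᶠ-true {a = b} b==y′
    ... | refl | refl = cong (mid y y′) (≡-irrelevant e′ e)

  -- L plays the role of ℓ′′ for Ec = E ∖ E_d: an edge (a,b) of E lies in E_d iff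
  -- some del_j with j < n holds at v_ab.
  record Encodes (n : ℕ) (L : VLabelling) (Ec : Edges k) : Set where
    field
      ap-agrees : ∀ v p → L v (ap p) ≡ ℓ' ℓ v (ap p)
      inter-agrees : ∀ v → L v inter ≡ ℓ' ℓ v inter
      ⊆E : ∀ {a b} → Ec a b ≡ true → E a b ≡ true
      kept-⇔-unmarked : ∀ {a b} (e : E a b ≡ true) →
        Ec a b ≡ true ⇔ (∀ j → j < n → L (mid a b e) (del j) ≡ false)
  open Encodes

  del≢del : ∀ {j n} → j < n → del {m} j ≢ del n
  del≢del j<n refl = <-irrefl refl j<n

  encodes-removeEdge : ∀ {n L L′ Ec y y′} → Encodes n L Ec →
    (∀ v q → q ≢ del n → L′ v q ≡ L v q) → (∀ v → L′ v (del n) ≡ marks y y′ v) →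
    Encodes (suc n) L′ (removeEdge Ec y y′)
  encodes-removeEdge {n} {L} {L′} {Ec} {y} {y′} enc agree marked = record
    { ap-agrees = λ v p → trans (agree v (ap p) λ ()) (ap-agrees enc v p)
    ; inter-agrees = λ v → trans (agree v inter λ ()) (inter-agrees enc v)
    ; ⊆E = ⊆E enc ∘ proj₁ ∘ to ∧-≡-true
    ; kept-⇔-unmarked = kept
    }
    where
    open import Relation.Binary.Reasoning.Setoid (⇔-setoid 0ℓ)
    kept : ∀ {a b} (e : E a b ≡ true) →
      removeEdge Ec y y′ a b ≡ true ⇔ (∀ j → j < suc n → L′ (mid a b e) (del j) ≡ false)
    kept {a} {b} e = begin
      removeEdge Ec y y′ a b ≡ true
        ≈⟨ ∧-≡-true ⟩
      (Ec a b ≡ true × not (marks y y′ (mid a b e)) ≡ true)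
        ≈⟨ kept-⇔-unmarked enc e ×-⇔ not-≡-true ⟩
      ((∀ j → j < n → L (mid a b e) (del j) ≡ false) × marks y y′ (mid a b e) ≡ false)
        ≈⟨ below-agree ×-⇔ mk⇔ (trans (marked _)) (trans (sym (marked _))) ⟩
      ((∀ j → j < n → L′ (mid a b e) (del j) ≡ false) × L′ (mid a b e) (del n) ≡ false)
        ≈⟨ ⇔-sym ∀<suc-⇔ ⟩
      (∀ j → j < suc n → L′ (mid a b e) (del j) ≡ false) ∎
      where
      below-agree : (∀ j → j < n → L (mid a b e) (del j) ≡ false) ⇔
                    (∀ j → j < n → L′ (mid a b e) (del j) ≡ false)
      below-agree = mk⇔ (λ f j j<n → trans (agree _ _ (del≢del j<n)) (f j j<n))
                        (λ f j j<n → trans (sym (agree _ _ (del≢del j<n))) (f j j<n))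

  no-inter-at-old : ∀ (L : VLabelling) → (∀ v → L v inter ≡ ℓ' ℓ v inter) →
                    ∀ z χ → ¬ qsat K⟨ L ⟩ (old z) (var inter ∧q χ)
  no-inter-at-old L agrees z χ h = ∧q-elim h λ (i , _) → ≡false⇒≢true (agrees (old z)) i

  -- The witness labelling for ⟨gone⟩ and ⟨gone⟩_loc: del_n marks exactly v_yy′.
  module Deletion {n L Ec} (enc : Encodes n L Ec) {y y′} (ec : Ec y y′ ≡ true) where

    e : E y y′ ≡ true
    e = ⊆E enc ec

    L′ : VLabelling
    L′ = update L (del n) (marks y y′)

    L′-agrees : ∀ v q → q ≢ del n → L′ v q ≡ L v q
    L′-agrees = update-≢ L (marks y y′) (del n)

    L′-marks : ∀ v → L′ v (del n) ≡ marks y y′ v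
    L′-marks = update-≡ L (marks y y′) (del n)

    encodes′ : Encodes (suc n) L′ (removeEdge Ec y y′)
    encodes′ = encodes-removeEdge enc L′-agrees L′-marks

    marked : L′ (mid y y′ e) (del n) ≡ true
    marked = trans (L′-marks _) (from (marks-true-⇔ e _) refl)

    deleted : qsat K⟨ L′ ⟩ (mid y y′ e) (deletedEdge n)
    deleted = from (deletedEdge-⇔ K⟨ L′ ⟩ n)
      ( trans (L′-agrees _ inter λ ()) (inter-agrees enc _)
      , (λ j j<n → trans (L′-agrees _ _ (del≢del j<n)) (to (kept-⇔-unmarked enc e) ec j j<n))
      , marked )

    uniquely-deleted : ∀ x → qsat K⟨ L′ ⟩ (old x) (E=1F (var (del n)))
    uniquely-deleted x = E=1F-intro K⟨ L′ ⟩ (reach {L′} x) {del n} (λ ()) marked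
      λ v h → to (marks-true-⇔ e v) (trans (sym (L′-marks v)) h)

  deletedEdge-not-old : ∀ {n L L′ Ec} → Encodes n L Ec → (∀ v q → q ≢ del n → L′ v q ≡ L v q) →
    ∀ z → ¬ qsat K⟨ L′ ⟩ (old z) (deletedEdge n)
  deletedEdge-not-old {n} {L′ = L′} enc agree z =
    no-inter-at-old L′ (λ v → trans (agree v inter λ ()) (inter-agrees enc v)) z
      (notDelBelow n ∧q var (del n))

  uniquely-marked⇒removed : ∀ {n L L′ Ec x a b e} → Encodes n L Ec →
    (∀ v q → q ≢ del n → L′ v q ≡ L v q) →
    qsat K⟨ L′ ⟩ (old x) (E=1F (var (del n))) → qsat K⟨ L′ ⟩ (mid a b e) (deletedEdge n) →
    Ec a b ≡ true × Encodes (suc n) L′ (removeEdge Ec a b)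
  uniquely-marked⇒removed {n} {L} {L′} {x = x} {a} {b} {e} enc agree unique deleted =
    from (kept-⇔-unmarked enc e) unmarked , encodes-removeEdge enc agree marks-agree
    where
    facts = to (deletedEdge-⇔ K⟨ L′ ⟩ {mid a b e} n) deleted
    marked : L′ (mid a b e) (del n) ≡ true
    marked = proj₂ (proj₂ facts)
    unmarked : ∀ j → j < n → L (mid a b e) (del j) ≡ false
    unmarked j j<n = trans (sym (agree _ _ (del≢del j<n))) (proj₁ (proj₂ facts) j j<n)
    only-v_ab : ∀ v → L′ v (del n) ≡ true ⇔ v ≡ mid a b e
    only-v_ab v = mk⇔ (λ h → E=1F-unique K⟨ L′ ⟩ (reach {L′} x) {del n} (λ ()) _≟V_ unique h marked)
                      (λ { refl → marked })
    marks-agree : ∀ v → L′ v (del n) ≡ marks a b v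
    marks-agree v = ≡true-⇔⇒≡ (⇔-trans (only-v_ab v) (⇔-sym (marks-true-⇔ e v)))

  sound : ∀ φ {n L Ec} → Encodes n L Ec → ∀ x → sat Ec ℓ x φ → qsat K⟨ L ⟩ (old x) (tr n φ)
  complete : ∀ φ {n L Ec} → Encodes n L Ec → ∀ x → qsat K⟨ L ⟩ (old x) (tr n φ) → ¬ ¬ sat Ec ℓ x φ

  sound (atom p) enc x s = trans (ap-agrees enc (old x) p) s
  sound ⊤ˢ {L = L} enc x _ = ⊤q-holds K⟨ L ⟩ (old x)
  sound (¬ˢ φ) enc x ¬s q = complete φ enc x q ¬s
  sound (φ ∧ˢ ψ) enc x (s , t) = ∧q-intro (sound φ enc x s) (sound ψ enc x t)
  sound (◇ φ) {L = L} enc x (x′ , ec , s) =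
    mid x x′ e , refl , ∧q-intro (inter-agrees enc (mid x x′ e))
      (∧q-intro (from (notDelBelow-⇔ K⟨ L ⟩ _) (to (kept-⇔-unmarked enc e) ec))
                (old x′ , refl , sound φ enc x′ s))
    where e = ⊆E enc ec
  sound (gone φ) enc x (y , y′ , ec , s) =
    L′ , L′-agrees , ∧q-intro (uniquely-deleted x)
      (∧q-intro (old y , tt , mid y y′ e , refl , deleted) (sound φ encodes′ x s))
    where open Deletion enc ec
  sound (goneLoc φ) enc x (x′ , ec , s) =
    L′ , L′-agrees , ∧q-intro (uniquely-deleted x)
      (∧q-intro (mid x x′ e , refl , deleted) (sound φ encodes′ x s))
    where open Deletion enc ec

  complete (atom p) enc x q = return (trans (sym (ap-agrees enc (old x) p)) q)
  complete ⊤ˢ enc x _ = return tt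
  complete (¬ˢ φ) enc x ¬t = return λ s → ¬t (sound φ enc x s)
  complete (φ ∧ˢ ψ) enc x q = do
    (qφ , qψ) ← ∧q-elim q
    s ← complete φ enc x qφ
    t ← complete ψ enc x qψ
    return (s , t)
  complete (◇ φ) {n} {L} enc x (old y , _ , q) =
    ⊥-elim (no-inter-at-old L (inter-agrees enc) y (notDelBelow n ∧q EX (tr n φ)) q)
  complete (◇ φ) {L = L} enc x (mid .x x′ e , refl , q) = do
    (_ , rest) ← ∧q-elim q
    (unmarked , next) ← ∧q-elim rest
    s ← complete φ enc x′ (EX-mid (tr _ φ) next)
    return (x′ , from (kept-⇔-unmarked enc e) (to (notDelBelow-⇔ K⟨ L ⟩ _) unmarked) , s)
  complete (gone φ) {n} {L} {Ec} enc x (L′ , agree , q) = do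
    (unique , rest) ← ∧q-elim q
    ((_ , _ , w , _ , deleted) , t) ← ∧q-elim rest
    via w deleted unique t
    where
    via : ∀ w → qsat K⟨ L′ ⟩ w (deletedEdge n) → qsat K⟨ L′ ⟩ (old x) (E=1F (var (del n))) →
          qsat K⟨ L′ ⟩ (old x) (tr (suc n) φ) → ¬ ¬ sat Ec ℓ x (gone φ)
    via (old z) deleted _ _ = ⊥-elim (deletedEdge-not-old enc agree z deleted)
    via (mid a b e) deleted unique t = do
      let (ec , encodes′) = uniquely-marked⇒removed enc agree unique deleted
      s ← complete φ encodes′ x t
      return (a , b , ec , s)
  complete (goneLoc φ) {n} {L} {Ec} enc x (L′ , agree , q) = do
    (unique , rest) ← ∧q-elim q
    ((w , x→w , deleted) , t) ← ∧q-elim rest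
    via w x→w deleted unique t
    where
    via : ∀ w → E' (old x) w → qsat K⟨ L′ ⟩ w (deletedEdge n) →
          qsat K⟨ L′ ⟩ (old x) (E=1F (var (del n))) →
          qsat K⟨ L′ ⟩ (old x) (tr (suc n) φ) → ¬ ¬ sat Ec ℓ x (goneLoc φ)
    via (old z) _ deleted _ _ = ⊥-elim (deletedEdge-not-old enc agree z deleted)
    via (mid .x b e) refl deleted unique t = do
      let (ec , encodes′) = uniquely-marked⇒removed enc agree unique deleted
      s ← complete φ encodes′ x t
      return (b , ec , s)

  sat? : ∀ Ec x φ → Dec (sat Ec ℓ x φ)
  sat? Ec x (atom p) = ℓ x p Bool.≟ true
  sat? Ec x ⊤ˢ = yes tt
  sat? Ec x (¬ˢ φ) = ¬? (sat? Ec x φ)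
  sat? Ec x (φ ∧ˢ ψ) = sat? Ec x φ ×-dec sat? Ec x ψ
  sat? Ec x (◇ φ) = any? λ x′ → (Ec x x′ Bool.≟ true) ×-dec sat? Ec x′ φ
  sat? Ec x (gone φ) =
    any? λ y → any? λ y′ → (Ec y y′ Bool.≟ true) ×-dec sat? (removeEdge Ec y y′) x φ
  sat? Ec x (goneLoc φ) =
    any? λ x′ → (Ec x x′ Bool.≟ true) ×-dec sat? (removeEdge Ec x x′) x φ

  module _ {n : ℕ} (Ed : Fin n → Fin k × Fin k) where

    inEd : Fin k → Fin k → Fin n → Bool
    inEd a b i = (a ==ᶠ proj₁ (Ed i)) ∧ (b ==ᶠ proj₂ (Ed i))

    delLabel-< : ∀ {a b j} (j<n : j < n) → delLabel n Ed a b j ≡ inEd a b (fromℕ< j<n)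
    delLabel-< {j = j} j<n with j <? n
    ... | yes _ = refl
    ... | no j≮n = contradiction j<n j≮n

    encodes-initial : Encodes n (ℓ'' ℓ n Ed) (removeEdges E Ed)
    encodes-initial = record
      { ap-agrees = λ { (old _) _ → refl ; (mid _ _ _) _ → refl }
      ; inter-agrees = λ { (old _) → refl ; (mid _ _ _) → refl }
      ; ⊆E = proj₁ ∘ to ∧-≡-true
      ; kept-⇔-unmarked = kept
      }
      where
      open import Relation.Binary.Reasoning.Setoid (⇔-setoid 0ℓ)
      kept : ∀ {a b} (e : E a b ≡ true) →
        removeEdges E Ed a b ≡ true ⇔ (∀ j → j < n → delLabel n Ed a b j ≡ false)
      kept {a} {b} e = begin
        removeEdges E Ed a b ≡ true                            ≈⟨ ∧-≡-true ⟩
        (E a b ≡ true × not (anyFin (inEd a b)) ≡ true)        ≈⟨ mk⇔ proj₂ (e ,_) ⟩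
        not (anyFin (inEd a b)) ≡ true                         ≈⟨ not-≡-true ⟩
        anyFin (inEd a b) ≡ false                              ≈⟨ anyFin-≡-false (inEd a b) ⟩
        (∀ i → inEd a b i ≡ false)                             ≈⟨ ∀-Fin-⇔-∀-< ⟩
        (∀ j (j<n : j < n) → inEd a b (fromℕ< j<n) ≡ false)
          ≈⟨ mk⇔ (λ h j j<n → trans (delLabel-< j<n) (h j j<n))
                 (λ h j j<n → trans (sym (delLabel-< j<n)) (h j j<n)) ⟩
        (∀ j → j < n → delLabel n Ed a b j ≡ false)            ∎

proposition1 : ∀ {m k : ℕ} (E : Edges k) (ℓ : Labelling k m) (x : Fin k)
    (Φ ψ : SML m) (n : ℕ) → OccursAt ψ Φ n →
    (Ed : Fin n → Fin k × Fin k) → (∀ i → E (proj₁ (Ed i)) (proj₂ (Ed i)) ≡ true) →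
    sat (removeEdges E Ed) ℓ x ψ ⇔ qsat (K'' E ℓ n Ed) (old x) (tr n ψ)
proposition1 E ℓ x Φ ψ n _ Ed _ =
  mk⇔ (sound ψ (encodes-initial Ed) x)
      (decidable-stable (sat? (removeEdges E Ed) x ψ) ∘ complete ψ (encodes-initial Ed) x)
  where open Translation E ℓ
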